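{- All Allen modal operators $\mathsf{A},\mathsf{L},\mathsf{B},\mathsf{E},\mathsf{D},\mathsf{O}$ are expressible in Temporal Ensemble Logic: there is a map $\tau$ from TCL formulas to TEL formulas without free time variables such that for every TCL formula $\varphi$, every $\alpha:\mathbb{M}^+\to2^{\mathsf{Prop}}$, every environment $\mathcal{E}=(\alpha,\beta,\eta)$ and every $s\in\mathbb{M}^+$, $(\alpha,s)\models\varphi$ (TCL) iff $(\mathcal{E},s)\models\tau(\varphi)$ (TEL).
   Context: Let $(\mathbb{M},+,0)$ be a commutative monoid with a total order $<$ compatible with $+$, such that $a<b$ iff $a+c=b$ for some $c>0$, and $a<a+x$ for all $x\ne0$; $\mathbb{M}^+$ is its set of positive elements. TEL: time terms $s,t::=a\mid x\mid s+t$ (constants $a$, variables $x$); formulas $\varphi::=p\mid\varphi_t\mid\neg\varphi\mid\varphi\wedge\psi\mid\varphi\vee\psi\mid\Box_t\varphi\mid\Diamond_t\varphi\mid\exists x\varphi\mid\forall x\varphi$ ($p\in\mathsf{Prop}$). Environment $\mathcal{E}=(\alpha,\beta,\eta)$: $\alpha:\mathbb{M}^+\to2^{\mathsf{Prop}}$, $\beta$ maps terms to $\mathbb{M}^+$ with $\beta(s+t)=\beta(s)+\beta(t)$, $\eta$ maps variables to $\mathbb{M}^+$. $(\mathcal{E},s)\models p$ iff $p\in\alpha(s)$; Boolean as usual; $(\mathcal{E},s)\models\varphi_t$ iff $(\mathcal{E},s+\beta(t))\models\varphi$; $\Diamond_t\varphi$ (resp. $\Box_t\varphi$) holds at $s$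 iff $\varphi$ holds at some (resp. every) $u$ with $s\le u<s+\beta(t)$; $\exists x\varphi$ (resp. $\forall x\varphi$) holds at $s$ iff $\varphi$ holds at $s$ in the environment with $\eta$ replaced by $\eta[x:=a]$ for some (resp. all) $a\in\mathbb{M}^+$. TCL formulas: $\varphi,\psi::=p\mid\neg\varphi\mid\varphi\wedge\psi\mid\varphi\vee\psi\mid\varphi X\psi$ with $X\in\{\mathsf{A},\mathsf{L},\mathsf{B},\mathsf{E},\mathsf{D},\mathsf{O}\}$; semantics w.r.t. $\alpha:\mathbb{M}^+\to2^{\mathsf{Prop}}$ and $s\in\mathbb{M}^+$: atoms and Boolean connectives as for TEL; writing $\overline{\chi}$ for $\neg\chi$ and "$\chi$ on $I$" for "$(\alpha,t)\models\chi$ for all $t\in I\cap\mathbb{M}^+$": $(\alpha,s)\models\varphi\mathsf{A}\psi$ iff there are $v>u>s$ with $\varphi\wedge\overline\psi$ on $[s,u)$, $\psi\wedge\overline\varphi$ on $[u,v)$, $\overline\varphi\wedge\overline\psi$ on $[v,\infty)$; $\varphi\mathsf{L}\psi$ iff there are $w>v>u>s$ with $\varphi\wedge\overline\psi$ on $[s,u)$, $\overline\varphi\wedge\overline\psi$ on $[u,v)$, $\overline\varphi\wedge\psi$ on $[v,w)$, $\overline\varphi\wedge\overline\psi$ on $[w,\infty)$; $\varphi\mathsf{B}\psi$ iff there are $v>u>s$ with $\varphi\wedge\psi$ on $[s,u)$, $\varphi\wedge\overline\psi$ on $[u,v)$, $\overline\varphi\wedge\overline\psi$ on $[v,\infty)$;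 $\varphi\mathsf{E}\psi$ iff there are $v>u>s$ with $\varphi\wedge\overline\psi$ on $[s,u)$, $\varphi\wedge\psi$ on $[u,v)$, $\overline\varphi\wedge\overline\psi$ on $[v,\infty)$; $\varphi\mathsf{D}\psi$ iff there are $w>v>u>s$ with $\varphi\wedge\overline\psi$ on $[s,u)$, $\varphi\wedge\psi$ on $[u,v)$, $\varphi\wedge\overline\psi$ on $[v,w)$, $\overline\varphi\wedge\overline\psi$ on $[w,\infty)$; $\varphi\mathsf{O}\psi$ iff there are $w>v>u>s$ with $\varphi\wedge\overline\psi$ on $[s,u)$, $\varphi\wedge\psi$ on $[u,v)$, $\overline\varphi\wedge\psi$ on $[v,w)$, $\overline\varphi\wedge\overline\psi$ on $[w,\infty)$. -}

module Defs where

open import Data.Nat using (ℕ; _≟_)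
open import Data.Unit using (⊤)
open import Data.Bool using (Bool; true; false)
open import Data.Product using (Σ; ∃; _×_; _,_; proj₁; proj₂)
open import Data.Sum using (_⊎_; inj₁; inj₂)
open import Data.List using (List; []; _∷_)
open import Data.List.Membership.Propositional using (_∈_)
open import Relation.Nullary using (¬_; yes; no)
open import Relation.Binary.PropositionalEquality using (_≡_; _≢_; refl; subst)
open import Relation.Binary.Structures using (IsStrictTotalOrder)
open import Algebra.Structures using (IsCommutativeMonoid)

record TimeMonoid : Set₁ where
  field
    Carrier : Set
    _+_     : Carrier → Carrier → Carrier
    0#      : Carrier
    _<_     : Carrier → Carrier → Set
    isCommutativeMonoid : IsCommutativeMonoid _≡_ _+_ 0#
    isStrictTotalOrder  : IsStrictTotalOrder _≡_ _<_

  _≤_ : Carrier → Carrier → Set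
  a ≤ b = (a ≡ b) ⊎ (a < b)

  field
    +-mono-≤ : ∀ {a b} c → a ≤ b → (a + c) ≤ (b + c)
    <⇒∃    : ∀ {a b} → a < b → Σ Carrier λ c → (0# < c) × ((a + c) ≡ b)
    ∃⇒<    : ∀ {a b c} → 0# < c → (a + c) ≡ b → a < b
    <-+    : ∀ a x → x ≢ 0# → a < (a + x)

  open IsStrictTotalOrder isStrictTotalOrder using (trans; irrefl)

  Pos : Set
  Pos = Σ Carrier (0# <_)

  private
    pos≢0 : ∀ {b} → 0# < b → b ≢ 0#
    pos≢0 {b} p b≡0 = irrefl refl (subst (0# <_) b≡0 p)

  _⊕_ : Pos → Pos → Pos
  (a , pa) ⊕ (b , pb) = (a + b) , trans pa (<-+ a b (pos≢0 pb))

data Allen : Set where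
  𝖠 𝖫 𝖡 𝖤 𝖣 𝖮 : Allen

module Logic (M : TimeMonoid) (AP : Set) (Const : Set) where
  open TimeMonoid M

  Var : Set
  Var = ℕ

  data Term : Set where
    con  : Const → Term
    var  : Var → Term
    _⊞_  : Term → Term → Term

  data TEL : Set where
    atom : AP → TEL
    at   : TEL → Term → TEL
    neg  : TEL → TEL
    conj : TEL → TEL → TEL
    disj : TEL → TEL → TEL
    box  : Term → TEL → TEL
    dia  : Term → TEL → TEL
    ex   : Var → TEL → TEL
    all  : Var → TEL → TEL

  data TCL : Set where
    atom : AP → TCL
    neg  : TCL → TCL
    conj : TCL → TCL → TCL
    disj : TCL → TCL → TCL
    op   : TCL → Allen → TCL → TCL

  Valuation : Set
  Valuation = Pos → AP → Bool

  record Env : Set where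
    constructor env
    field
      α : Valuation
      β : Const → Pos
      η : Var → Pos

  open Env

  ⟦_⟧ : Term → Env → Pos
  ⟦ con c ⟧ E = β E c
  ⟦ var x ⟧ E = η E x
  ⟦ s ⊞ t ⟧ E = ⟦ s ⟧ E ⊕ ⟦ t ⟧ E

  update : (Var → Pos) → Var → Pos → Var → Pos
  update η x a y with y ≟ x
  ... | yes _ = a
  ... | no  _ = η y

  _[_≔_] : Env → Var → Pos → Env
  E [ x ≔ a ] = env (α E) (β E) (update (η E) x a)

  _,_⊨ᴱ_ : Env → Pos → TEL → Set
  E , s ⊨ᴱ atom p     = α E s p ≡ true
  E , s ⊨ᴱ at φ t     = E , (s ⊕ ⟦ t ⟧ E) ⊨ᴱ φ
  E , s ⊨ᴱ neg φ      = ¬ (E , s ⊨ᴱ φ)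
  E , s ⊨ᴱ conj φ ψ   = (E , s ⊨ᴱ φ) × (E , s ⊨ᴱ ψ)
  E , s ⊨ᴱ disj φ ψ   = (E , s ⊨ᴱ φ) ⊎ (E , s ⊨ᴱ ψ)
  E , s ⊨ᴱ box t φ    = (u : Pos) → proj₁ s ≤ proj₁ u → proj₁ u < proj₁ (s ⊕ ⟦ t ⟧ E) → E , u ⊨ᴱ φ
  E , s ⊨ᴱ dia t φ    = Σ Pos λ u → (proj₁ s ≤ proj₁ u) × (proj₁ u < proj₁ (s ⊕ ⟦ t ⟧ E)) × (E , u ⊨ᴱ φ)
  E , s ⊨ᴱ ex x φ     = Σ Pos λ a → (E [ x ≔ a ]) , s ⊨ᴱ φ
  E , s ⊨ᴱ all x φ    = (a : Pos) → (E [ x ≔ a ]) , s ⊨ᴱ φ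

  TermClosedUnder : List Var → Term → Set
  TermClosedUnder bs (con c) = ⊤
  TermClosedUnder bs (var x) = x ∈ bs
  TermClosedUnder bs (s ⊞ t) = TermClosedUnder bs s × TermClosedUnder bs t

  ClosedUnder : List Var → TEL → Set
  ClosedUnder bs (atom p)   = ⊤
  ClosedUnder bs (at φ t)   = ClosedUnder bs φ × TermClosedUnder bs t
  ClosedUnder bs (neg φ)    = ClosedUnder bs φ
  ClosedUnder bs (conj φ ψ) = ClosedUnder bs φ × ClosedUnder bs ψ
  ClosedUnder bs (disj φ ψ) = ClosedUnder bs φ × ClosedUnder bs ψ
  ClosedUnder bs (box t φ)  = TermClosedUnder bs t × ClosedUnder bs φ
  ClosedUnder bs (dia t φ)  = TermClosedUnder bs t × ClosedUnder bs φ
  ClosedUnder bs (ex x φ)   = ClosedUnder (x ∷ bs) φ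
  ClosedUnder bs (all x φ)  = ClosedUnder (x ∷ bs) φ

  Closed : TEL → Set
  Closed = ClosedUnder []

  Lit : Set → Bool → Set
  Lit P true  = P
  Lit P false = ¬ P

  mutual
    _,_⊨ᶜ_ : Valuation → Pos → TCL → Set
    a , s ⊨ᶜ atom p     = a s p ≡ true
    a , s ⊨ᶜ neg φ      = ¬ (a , s ⊨ᶜ φ)
    a , s ⊨ᶜ conj φ ψ   = (a , s ⊨ᶜ φ) × (a , s ⊨ᶜ ψ)
    a , s ⊨ᶜ disj φ ψ   = (a , s ⊨ᶜ φ) ⊎ (a , s ⊨ᶜ ψ)
    a , s ⊨ᶜ op φ X ψ   = AllenSat a s φ X ψ

    Pat : Valuation → Pos → TCL → Bool → TCL → Bool → Set
    Pat a t φ bφ ψ bψ = Lit (a , t ⊨ᶜ φ) bφ × Lit (a , t ⊨ᶜ ψ) bψ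

    OnInt : Valuation → TCL → Bool → TCL → Bool → Carrier → Carrier → Set
    OnInt a φ bφ ψ bψ l r = (t : Pos) → l ≤ proj₁ t → proj₁ t < r → Pat a t φ bφ ψ bψ

    OnRay : Valuation → TCL → Bool → TCL → Bool → Carrier → Set
    OnRay a φ bφ ψ bψ l = (t : Pos) → l ≤ proj₁ t → Pat a t φ bφ ψ bψ

    AllenSat : Valuation → Pos → TCL → Allen → TCL → Set
    AllenSat a (s , _) φ 𝖠 ψ =
      Σ Carrier λ u → Σ Carrier λ v → (s < u) × (u < v) ×
        OnInt a φ true ψ false s u × OnInt a φ false ψ true u v × OnRay a φ false ψ false v
    AllenSat a (s , _) φ 𝖫 ψ =
      Σ Carrier λ u → Σ Carrier λ v → Σ Carrier λ w → (s < u) × (u < v) × (v < w) ×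
        OnInt a φ true ψ false s u × OnInt a φ false ψ false u v ×
        OnInt a φ false ψ true v w × OnRay a φ false ψ false w
    AllenSat a (s , _) φ 𝖡 ψ =
      Σ Carrier λ u → Σ Carrier λ v → (s < u) × (u < v) ×
        OnInt a φ true ψ true s u × OnInt a φ true ψ false u v × OnRay a φ false ψ false v
    AllenSat a (s , _) φ 𝖤 ψ =
      Σ Carrier λ u → Σ Carrier λ v → (s < u) × (u < v) ×
        OnInt a φ true ψ false s u × OnInt a φ true ψ true u v × OnRay a φ false ψ false v
    AllenSat a (s , _) φ 𝖣 ψ =
      Σ Carrier λ u → Σ Carrier λ v → Σ Carrier λ w → (s < u) × (u < v) × (v < w) ×
        OnInt a φ true ψ false s u × OnInt a φ true ψ true u v ×
        OnInt a φ true ψ false v w × OnRay a φ false ψ false w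
    AllenSat a (s , _) φ 𝖮 ψ =
      Σ Carrier λ u → Σ Carrier λ v → Σ Carrier λ w → (s < u) × (u < v) × (v < w) ×
        OnInt a φ true ψ false s u × OnInt a φ true ψ true u v ×
        OnInt a φ false ψ true v w × OnRay a φ false ψ false w

module Submission where

open import Defs
open import Data.Bool using (Bool; true; false)
open import Data.Unit using (tt)
open import Data.Product using (Σ; _×_; _,_; proj₁; proj₂)
open import Data.Product.Function.NonDependent.Propositional using (_×-⇔_)
open import Data.Sum.Function.Propositional using (_⊎-⇔_)
open import Data.List using (List; []; _∷_; map)
open import Data.List.Relation.Unary.Any using (here)
open import Data.List.Relation.Unary.All as All using (All; []; _∷_)
open import Data.List.Relation.Unary.All.Properties as All using ()
open import Data.List.Relation.Binary.Pointwise as Pointwise using (Pointwise; []; _∷_)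
open import Data.List.Relation.Binary.Subset.Propositional using (_⊆_)
open import Data.List.Relation.Binary.Subset.Propositional.Properties using (∷⁺ʳ)
open import Relation.Binary.PropositionalEquality using (_≡_; refl; subst)
open import Relation.Binary.Structures using (IsStrictTotalOrder)
open import Algebra.Structures using (IsCommutativeMonoid)
open import Relation.Nullary using (¬_)
open import Function.Bundles using (_⇔_; mk⇔; Equivalence)
open import Function.Construct.Identity using (⇔-id)
open import Function.Construct.Composition using (_⇔-∘_)
open import Function.Related.TypeIsomorphisms using (¬-cong-⇔)

-- Each Allen operator says that the sign pattern of (φ, ψ) runs through a fixed
-- sequence of constant pieces on consecutive intervals [s, u), [u, v), … and is
-- ¬φ ∧ ¬ψ from the last endpoint on. In TEL, "χ on [s, s + x) and then the rest
-- from s + x on" is ∃x (□ₓ χ ∧ (rest)ₓ), and "χ on [s, ∞)" is ∀x □ₓ χ, because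
-- every t ≥ s lies below s + t. Each quantifier is consumed by the shift right
-- after it, so one time variable suffices throughout.

module Translation (M : TimeMonoid) (AP Const : Set) where
  open TimeMonoid M
  open Logic M AP Const
  open Equivalence

  pos⇒≢0 : ∀ {a} → 0# < a → ¬ (a ≡ 0#)
  pos⇒≢0 {a} 0<a a≡0 = IsStrictTotalOrder.irrefl isStrictTotalOrder refl (subst (0# <_) a≡0 0<a)

  m<n+m : ∀ {n} m → 0# < n → m < (n + m)
  m<n+m {n} m 0<n =
    subst (m <_) (IsCommutativeMonoid.comm isCommutativeMonoid m n) (<-+ m n (pos⇒≢0 0<n))

  x₀ : Term
  x₀ = var 0

  lit : Bool → TEL → TEL
  lit true  φ = φ
  lit false φ = neg φ

  signs : TEL → TEL → Bool × Bool → TEL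
  signs φ ψ (bφ , bψ) = conj (lit bφ φ) (lit bψ ψ)

  intervals : List TEL → TEL → TEL
  intervals []       ray = all 0 (box x₀ ray)
  intervals (χ ∷ χs) ray = ex 0 (conj (box x₀ χ) (at (intervals χs ray) x₀))

  shape : Allen → List (Bool × Bool)
  shape 𝖠 = (true , false) ∷ (false , true) ∷ []
  shape 𝖫 = (true , false) ∷ (false , false) ∷ (false , true) ∷ []
  shape 𝖡 = (true , true) ∷ (true , false) ∷ []
  shape 𝖤 = (true , false) ∷ (true , true) ∷ []
  shape 𝖣 = (true , false) ∷ (true , true) ∷ (true , false) ∷ []
  shape 𝖮 = (true , false) ∷ (true , true) ∷ (false , true) ∷ []

  τ : TCL → TEL
  τ (atom p)   = atom p
  τ (neg φ)    = neg (τ φ)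
  τ (conj φ ψ) = conj (τ φ) (τ ψ)
  τ (disj φ ψ) = disj (τ φ) (τ ψ)
  τ (op φ X ψ) = intervals (map (signs (τ φ) (τ ψ)) (shape X)) (signs (τ φ) (τ ψ) (false , false))

  weaken-term : ∀ {bs bs′} → bs ⊆ bs′ → ∀ t → TermClosedUnder bs t → TermClosedUnder bs′ t
  weaken-term bs⊆bs′ (con c) _         = tt
  weaken-term bs⊆bs′ (var x) x∈bs      = bs⊆bs′ x∈bs
  weaken-term bs⊆bs′ (s ⊞ t) (cs , ct) = weaken-term bs⊆bs′ s cs , weaken-term bs⊆bs′ t ct

  weaken : ∀ {bs bs′} → bs ⊆ bs′ → ∀ φ → ClosedUnder bs φ → ClosedUnder bs′ φ
  weaken bs⊆bs′ (atom p)   _         = tt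
  weaken bs⊆bs′ (at φ t)   (cφ , ct) = weaken bs⊆bs′ φ cφ , weaken-term bs⊆bs′ t ct
  weaken bs⊆bs′ (neg φ)    cφ        = weaken bs⊆bs′ φ cφ
  weaken bs⊆bs′ (conj φ ψ) (cφ , cψ) = weaken bs⊆bs′ φ cφ , weaken bs⊆bs′ ψ cψ
  weaken bs⊆bs′ (disj φ ψ) (cφ , cψ) = weaken bs⊆bs′ φ cφ , weaken bs⊆bs′ ψ cψ
  weaken bs⊆bs′ (box t φ)  (ct , cφ) = weaken-term bs⊆bs′ t ct , weaken bs⊆bs′ φ cφ
  weaken bs⊆bs′ (dia t φ)  (ct , cφ) = weaken-term bs⊆bs′ t ct , weaken bs⊆bs′ φ cφ
  weaken bs⊆bs′ (ex x φ)   cφ        = weaken (∷⁺ʳ x bs⊆bs′) φ cφ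
  weaken bs⊆bs′ (all x φ)  cφ        = weaken (∷⁺ʳ x bs⊆bs′) φ cφ

  closed⇒closedUnder : ∀ {bs} φ → Closed φ → ClosedUnder bs φ
  closed⇒closedUnder = weaken (λ ())

  lit-closed : ∀ {φ} b → Closed φ → Closed (lit b φ)
  lit-closed true  cφ = cφ
  lit-closed false cφ = cφ

  signs-closed : ∀ {φ ψ} → Closed φ → Closed ψ → ∀ b → Closed (signs φ ψ b)
  signs-closed cφ cψ (bφ , bψ) = lit-closed bφ cφ , lit-closed bψ cψ

  intervals-closed : ∀ {bs χs ray} → All Closed χs → Closed ray → ClosedUnder bs (intervals χs ray)
  intervals-closed {ray = ray} [] c-ray = here refl , closed⇒closedUnder ray c-ray
  intervals-closed {χs = χ ∷ _} (cχ ∷ cχs) c-ray =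
    (here refl , closed⇒closedUnder χ cχ) , intervals-closed cχs c-ray , here refl

  τ-closed : ∀ φ → Closed (τ φ)
  τ-closed (atom p)   = tt
  τ-closed (neg φ)    = τ-closed φ
  τ-closed (conj φ ψ) = τ-closed φ , τ-closed ψ
  τ-closed (disj φ ψ) = τ-closed φ , τ-closed ψ
  τ-closed (op φ X ψ) =
    intervals-closed (All.map⁺ (All.universal pieces-closed (shape X))) (pieces-closed (false , false))
    where
    pieces-closed : ∀ b → Closed (signs (τ φ) (τ ψ) b)
    pieces-closed = signs-closed (τ-closed φ) (τ-closed ψ)

  On : (Pos → Set) → Carrier → Carrier → Set
  On Q l r = (t : Pos) → l ≤ proj₁ t → proj₁ t < r → Q t

  Ray : (Pos → Set) → Carrier → Set
  Ray Q l = (t : Pos) → l ≤ proj₁ t → Q t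

  Chain : List (Pos → Set) → (Pos → Set) → Carrier → Set
  Chain []       R s = Ray R s
  Chain (Q ∷ Qs) R s = Σ Carrier λ u → (s < u) × On Q s u × Chain Qs R u

  On-cong : ∀ {Q Q′ : Pos → Set} {l r} → (∀ t → Q t ⇔ Q′ t) → On Q l r ⇔ On Q′ l r
  On-cong Q⇔Q′ = mk⇔ (λ on t l≤t t<r → to (Q⇔Q′ t) (on t l≤t t<r))
                     (λ on t l≤t t<r → from (Q⇔Q′ t) (on t l≤t t<r))

  Ray⇔On-all : ∀ {Q : Pos → Set} {Q′ : Pos → Pos → Set} {l} → 0# < l → (∀ z t → Q t ⇔ Q′ z t) →
               Ray Q l ⇔ ((z : Pos) → On (Q′ z) l (l + proj₁ z))
  Ray⇔On-all 0<l Q⇔Q′ =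
    mk⇔ (λ ray z t l≤t _ → to (Q⇔Q′ z t) (ray t l≤t))
        (λ on t l≤t → from (Q⇔Q′ t t) (on t t l≤t (m<n+m (proj₁ t) 0<l)))

  Chain₂ : ∀ {Q₁ Q₂ R s} →
    (Σ Carrier λ u → Σ Carrier λ v → (s < u) × (u < v) × On Q₁ s u × On Q₂ u v × Ray R v)
    ⇔ Chain (Q₁ ∷ Q₂ ∷ []) R s
  Chain₂ = mk⇔ (λ (u , v , s<u , u<v , on₁ , on₂ , ray) → u , s<u , on₁ , v , u<v , on₂ , ray)
               (λ (u , s<u , on₁ , v , u<v , on₂ , ray) → u , v , s<u , u<v , on₁ , on₂ , ray)

  Chain₃ : ∀ {Q₁ Q₂ Q₃ R s} →
    (Σ Carrier λ u → Σ Carrier λ v → Σ Carrier λ w → (s < u) × (u < v) × (v < w) ×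
       On Q₁ s u × On Q₂ u v × On Q₃ v w × Ray R w)
    ⇔ Chain (Q₁ ∷ Q₂ ∷ Q₃ ∷ []) R s
  Chain₃ = mk⇔
    (λ (u , v , w , s<u , u<v , v<w , on₁ , on₂ , on₃ , ray) →
       u , s<u , on₁ , v , u<v , on₂ , w , v<w , on₃ , ray)
    (λ (u , s<u , on₁ , v , u<v , on₂ , w , v<w , on₃ , ray) →
       u , v , w , s<u , u<v , v<w , on₁ , on₂ , on₃ , ray)

  Signs : Valuation → TCL → TCL → Bool × Bool → Pos → Set
  Signs α φ ψ (bφ , bψ) t = Pat α t φ bφ ψ bψ

  AllenSat⇔Chain : ∀ {α s φ ψ} X →
    AllenSat α s φ X ψ ⇔ Chain (map (Signs α φ ψ) (shape X)) (Signs α φ ψ (false , false)) (proj₁ s)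
  AllenSat⇔Chain 𝖠 = Chain₂
  AllenSat⇔Chain 𝖫 = Chain₃
  AllenSat⇔Chain 𝖡 = Chain₂
  AllenSat⇔Chain 𝖤 = Chain₂
  AllenSat⇔Chain 𝖣 = Chain₃
  AllenSat⇔Chain 𝖮 = Chain₃

  module Semantics (α : Valuation) (β : Const → Pos) where

    -- Quantifying over η spares a lemma that closed formulas ignore η.
    Expresses : (Pos → Set) → TEL → Set
    Expresses Q χ = ∀ η t → Q t ⇔ (env α β η , t ⊨ᴱ χ)

    lit-expresses : ∀ {P χ} b → Expresses P χ → Expresses (λ t → Lit (P t) b) (lit b χ)
    lit-expresses true  P⇔χ = P⇔χ
    lit-expresses false P⇔χ η t = ¬-cong-⇔ (P⇔χ η t)

    signs-expresses : ∀ φ ψ {χ₁ χ₂} → Expresses (α ,_⊨ᶜ φ) χ₁ → Expresses (α ,_⊨ᶜ ψ) χ₂ →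
                      ∀ b → Expresses (Signs α φ ψ b) (signs χ₁ χ₂ b)
    signs-expresses φ ψ φ⇔χ₁ ψ⇔χ₂ (bφ , bψ) η t =
      lit-expresses bφ φ⇔χ₁ η t ×-⇔ lit-expresses bψ ψ⇔χ₂ η t

    Chain⇔intervals : ∀ {Qs R χs ray} → Pointwise Expresses Qs χs → Expresses R ray →
                      ∀ η s → Chain Qs R (proj₁ s) ⇔ (env α β η , s ⊨ᴱ intervals χs ray)
    Chain⇔intervals [] R⇔ray η s =
      Ray⇔On-all (proj₂ s) (λ z → R⇔ray (update η 0 z))
    Chain⇔intervals {Q ∷ Qs} {R} {χ ∷ χs} {ray} (Q⇔χ ∷ Qs⇔χs) R⇔ray η s = mk⇔ forward backward
      where
      forward : Chain (Q ∷ Qs) R (proj₁ s) → env α β η , s ⊨ᴱ intervals (χ ∷ χs) ray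
      forward (u , s<u , on , chain) with <⇒∃ s<u
      ... | c , 0<c , refl =
        (c , 0<c) ,
        to (On-cong (Q⇔χ η′)) on ,
        to (Chain⇔intervals Qs⇔χs R⇔ray η′ (s ⊕ (c , 0<c))) chain
        where
        η′ : Var → Pos
        η′ = update η 0 (c , 0<c)
      backward : env α β η , s ⊨ᴱ intervals (χ ∷ χs) ray → Chain (Q ∷ Qs) R (proj₁ s)
      backward (c , on , rest) =
        proj₁ s + proj₁ c , ∃⇒< (proj₂ c) refl ,
        from (On-cong (Q⇔χ η′)) on ,
        from (Chain⇔intervals Qs⇔χs R⇔ray η′ (s ⊕ c)) rest
        where
        η′ : Var → Pos
        η′ = update η 0 c

    τ-correct : ∀ φ → Expresses (α ,_⊨ᶜ φ) (τ φ)
    τ-correct (atom p)   η t = ⇔-id _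
    τ-correct (neg φ)    η t = ¬-cong-⇔ (τ-correct φ η t)
    τ-correct (conj φ ψ) η t = τ-correct φ η t ×-⇔ τ-correct ψ η t
    τ-correct (disj φ ψ) η t = τ-correct φ η t ⊎-⇔ τ-correct ψ η t
    τ-correct (op φ X ψ) η s =
      Chain⇔intervals (Pointwise.map⁺ (Signs α φ ψ) (signs (τ φ) (τ ψ))
                         (Pointwise.refl (λ {b} → pieces-express b)))
                      (pieces-express (false , false)) η s
      ⇔-∘ AllenSat⇔Chain X
      where
      pieces-express : ∀ b → Expresses (Signs α φ ψ b) (signs (τ φ) (τ ψ) b)
      pieces-express = signs-expresses φ ψ (τ-correct φ) (τ-correct ψ)

mainTheorem11 : (M : TimeMonoid) (AP Const : Set) →
    let open Logic M AP Const in
    Σ (TCL → TEL) λ τ →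
      ((φ : TCL) → Closed (τ φ)) ×
      ((φ : TCL) (α : Valuation) (β : Const → TimeMonoid.Pos M)
       (η : Var → TimeMonoid.Pos M) (s : TimeMonoid.Pos M) →
        (α , s ⊨ᶜ φ) ⇔ (env α β η , s ⊨ᴱ τ φ))
mainTheorem11 M AP Const =
  τ , τ-closed , λ φ α β η s → Semantics.τ-correct α β φ η s
  where open Translation M AP Const
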